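{- Let $\sigma$ be a cyclic permutation of $[n]$ and let $\mathcal{G}$ be a $2$-Sperner family of intervals along $\sigma$ having exactly $I$ isolated intervals, where $1\le I\le n-1$. Then $|\mathcal{G}|\le 2n-I-1$.
   Context: A cyclic permutation of $[n]$ is an arrangement of $1,\dots,n$ around a circle; an interval along $\sigma$ is a nonempty set of circularly consecutive elements. A family is $2$-Sperner if it contains no three members $G_1\subsetneq G_2\subsetneq G_3$. A member of $\mathcal{G}$ is isolated if it is comparable (under inclusion) with no other member of $\mathcal{G}$. -}

module Defs where

open import Data.Nat using (ℕ; _+_; _∸_; _≤_; _<_; _≤ᵇ_)
open import Data.Bool using (if_then_else_)
open import Data.Fin using (Fin; toℕ)
open import Data.Fin.Subset using (Subset; _∈_; _⊆_; _⊂_)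
open import Data.Fin.Permutation using (Permutation′; _⟨$⟩ʳ_)
open import Data.List using (List; length)
import Data.List.Membership.Propositional as LM
open import Data.List.Relation.Unary.Unique.Propositional using (Unique)
open import Data.Product using (Σ; ∃; _×_)
open import Relation.Binary.PropositionalEquality using (_≡_; _≢_)
open import Relation.Nullary using (¬_)
open import Data.Empty using (⊥)
open import Function.Bundles using (_⇔_)

offset : {n : ℕ} → Fin n → Fin n → ℕ
offset {n} i p = if toℕ i ≤ᵇ toℕ p then toℕ p ∸ toℕ i else (n + toℕ p) ∸ toℕ i

-- The cyclic permutation σ is an arrangement of [n] around a circle:
-- σ ⟨$⟩ʳ p is the element sitting at position p (positions taken mod n).
-- x lies in the interval starting at position i of length k iff x sits at
-- a position p with circular offset from i less than k.
InInterval : {n : ℕ} → Permutation′ n → Fin n → ℕ → Fin n → Set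
InInterval σ i k x = ∃ λ p → (σ ⟨$⟩ʳ p ≡ x) × (offset i p < k)

IsInterval : {n : ℕ} → Permutation′ n → Subset n → Set
IsInterval {n} σ S =
  Σ (Fin n) λ i → Σ ℕ λ k → (1 ≤ k) × (k ≤ n) × (∀ x → (x ∈ S) ⇔ InInterval σ i k x)

IsFamily : {n : ℕ} → List (Subset n) → Set
IsFamily F = Unique F

TwoSperner : {n : ℕ} → List (Subset n) → Set
TwoSperner F = ∀ {A B C} → A LM.∈ F → B LM.∈ F → C LM.∈ F → A ⊂ B → B ⊂ C → ⊥

Isolated : {n : ℕ} → List (Subset n) → Subset n → Set
Isolated F A = A LM.∈ F × (∀ B → B LM.∈ F → B ≢ A → ¬ (A ⊆ B) × ¬ (B ⊆ A))

NumIsolated : {n : ℕ} → List (Subset n) → ℕ → Set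
NumIsolated F I = ∃ λ (L : List _) → Unique L × (∀ A → (A LM.∈ L) ⇔ Isolated F A) × (length L ≡ I)

module Submission where

open import Defs
open import Level using (Level)
open import Data.Nat using (ℕ; zero; suc; _+_; _*_; _∸_; _≤_; _<_; _≤ᵇ_; z≤n; s≤s)
open import Data.Nat.Properties
open import Data.Bool using (true; false; T)
open import Data.Unit using (tt)
open import Data.Fin using (Fin; toℕ; inject₁; fromℕ) renaming (zero to fzero; suc to fsuc)
open import Data.Fin.Properties using (toℕ-inject₁; toℕ-fromℕ; injective⇒≤; any?; all?; ¬∀⟶∃¬) renaming (_≟_ to _≟ᶠ_)
open import Data.Fin.Subset using (Subset; _∈_; _⊆_; _⊂_)
open import Data.Fin.Subset.Properties using (⊆-antisym; ⊂-irref; _⊂?_) renaming (_∈?_ to _∈ₛ?_)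
open import Data.Fin.Permutation using (Permutation′)
open import Data.Vec.Properties using (≡-dec)
import Data.Bool.Properties as Bool
open import Data.List using (List; []; _∷_; length; map; filter; _++_; lookup)
open import Data.List.Properties using (length-map; length-++; length-tabulate)
open import Data.List.Membership.Propositional using (find) renaming (_∈_ to _∈ₗ_)
import Data.List.Membership.DecPropositional as DecMembership
open import Data.List.Membership.Propositional.Properties
  using (∈-lookup; ∈-allFin; ∈-map⁺; ∈-map⁻; ∈-filter⁺; ∈-filter⁻; ∈-++⁺ˡ; ∈-++⁺ʳ; ∈-++⁻)
open import Data.List.Relation.Unary.Any using (here; there; index)
open import Data.List.Relation.Unary.Any.Properties using (lookup-index)
open import Data.List.Relation.Unary.All as All using (All; []; _∷_)
import Data.List.Relation.Unary.All.Properties as All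
open import Data.List.Relation.Unary.Unique.Propositional using (Unique; []; _∷_)
import Data.List.Relation.Unary.Unique.Propositional.Properties as Unique
open import Data.Product using (Σ; ∃; _×_; _,_; proj₁; proj₂)
open import Data.Sum using (_⊎_; inj₁; inj₂)
open import Data.Empty using (⊥; ⊥-elim)
open import Function using (_∘_)
open import Function.Bundles using (_⇔_; Equivalence)
open import Relation.Nullary using (¬_; Dec; yes; no; contradiction)
open import Relation.Nullary.Decidable using (_×-dec_; ¬?; decidable-stable)
open import Relation.Binary.PropositionalEquality

-- Split the family into its minimal members M and the rest N.  M is an antichain, and so
-- is N together with the isolated members (which are minimal, hence not in N): a
-- comparable pair inside N would extend to a 3-chain.  An antichain of intervals has at
-- most n members, since two intervals with the same starting point are comparable.  If it
-- has exactly n, every position starts a member, and the member starting at p + 1 is not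
-- shorter than the one starting at p (otherwise it would lie inside it); going once round
-- the circle, all members have the same length.  If both antichains were full, an
-- isolated member, lying in both, would give all of them one common length, and each
-- B ∈ N would coincide with the minimal member starting where B starts, which is absurd.
-- So |G| + I ≤ |M| + |N| + I ≤ 2n - 1; when N is empty this already follows from |M| ≤ n
-- and I ≤ n - 1.

private
  variable
    a b : Level
    A : Set a
    B : Set b

lookup-injective : {xs : List A} → Unique xs → ∀ i j → lookup xs i ≡ lookup xs j → i ≡ j
lookup-injective (_    ∷ _) fzero    fzero    _  = refl
lookup-injective (x∉xs ∷ _) fzero    (fsuc j) eq = contradiction eq (All.lookup x∉xs (∈-lookup j))
lookup-injective (x∉xs ∷ _) (fsuc i) fzero    eq = contradiction (sym eq) (All.lookup x∉xs (∈-lookup i))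
lookup-injective (_    ∷ u) (fsuc i) (fsuc j) eq = cong fsuc (lookup-injective u i j eq)

Unique⇒length≤ : {xs ys : List A} → Unique xs → (∀ {x} → x ∈ₗ xs → x ∈ₗ ys) → length xs ≤ length ys
Unique⇒length≤ {xs = xs} {ys} u xs⊆ys = injective⇒≤ position-injective
  where
    position : Fin (length xs) → Fin (length ys)
    position i = index (xs⊆ys (∈-lookup i))

    position-injective : ∀ {i j} → position i ≡ position j → i ≡ j
    position-injective {i} {j} eq = lookup-injective u i j (begin
      lookup xs i              ≡⟨ lookup-index (xs⊆ys (∈-lookup i)) ⟩
      lookup ys (position i)   ≡⟨ cong (lookup ys) eq ⟩
      lookup ys (position j)   ≡⟨ lookup-index (xs⊆ys (∈-lookup j)) ⟨
      lookup xs j              ∎)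
      where open ≡-Reasoning

Unique⇒length≤n : ∀ {n} {xs : List (Fin n)} → Unique xs → length xs ≤ n
Unique⇒length≤n {n} {xs} u =
  subst (length xs ≤_) (length-tabulate {n = n} (λ i → i)) (Unique⇒length≤ u (λ {x} _ → ∈-allFin x))

Unique-map⁺-on : {f : A → B} {xs : List A} →
                 (∀ {x y} → x ∈ₗ xs → y ∈ₗ xs → f x ≡ f y → x ≡ y) → Unique xs → Unique (map f xs)
Unique-map⁺-on inj []          = []
Unique-map⁺-on inj (x∉xs ∷ u) =
  All.map⁺ (All.tabulate (λ y∈xs fx≡fy → All.lookup x∉xs y∈xs (inj (here refl) (there y∈xs) fx≡fy)))
  ∷ Unique-map⁺-on (λ x∈ y∈ → inj (there x∈) (there y∈)) u

nonempty⇒∃∈ : {xs : List A} → 1 ≤ length xs → ∃ (_∈ₗ xs)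
nonempty⇒∃∈ {xs = x ∷ _} _ = x , here refl

Unique-map⇒injective-on : {f : A → B} {xs : List A} → Unique (map f xs) →
                          ∀ {x y} → x ∈ₗ xs → y ∈ₗ xs → f x ≡ f y → x ≡ y
Unique-map⇒injective-on {xs = _ ∷ _} (_     ∷ _) (here refl) (here refl) _  = refl
Unique-map⇒injective-on {f = f} {_ ∷ _} (fx∉ ∷ _) (here refl) (there y∈) eq =
  contradiction eq (All.lookup fx∉ (∈-map⁺ f y∈))
Unique-map⇒injective-on {f = f} {_ ∷ _} (fx∉ ∷ _) (there x∈) (here refl) eq =
  contradiction (sym eq) (All.lookup fx∉ (∈-map⁺ f x∈))
Unique-map⇒injective-on {xs = _ ∷ _} (_     ∷ u) (there x∈) (there y∈) eq = Unique-map⇒injective-on u x∈ y∈ eq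

⊆⇒≡⊎⊂ : ∀ {n} {p q : Subset n} → p ⊆ q → p ≡ q ⊎ p ⊂ q
⊆⇒≡⊎⊂ {p = p} {q} p⊆q with any? (λ x → (x ∈ₛ? q) ×-dec ¬? (x ∈ₛ? p))
... | yes (x , x∈q , x∉p) = inj₂ (p⊆q , x , x∈q , x∉p)
... | no  ∄x              = inj₁ (⊆-antisym p⊆q (λ {x} x∈q → decidable-stable (x ∈ₛ? p) (λ x∉p → ∄x (x , x∈q , x∉p))))

isolated⇒¬⊂ : ∀ {n} {F : List (Subset n)} {A B} → Isolated F A → B ∈ₗ F → ¬ (A ⊂ B)
isolated⇒¬⊂ (_ , incomparable) B∈F A⊂B =
  proj₁ (incomparable _ B∈F (λ B≡A → ⊂-irref (sym B≡A) A⊂B)) (proj₁ A⊂B)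

isolated⇒¬⊃ : ∀ {n} {F : List (Subset n)} {A B} → Isolated F A → B ∈ₗ F → ¬ (B ⊂ A)
isolated⇒¬⊃ (_ , incomparable) B∈F B⊂A =
  proj₂ (incomparable _ B∈F (λ B≡A → ⊂-irref B≡A B⊂A)) (proj₁ B⊂A)

∸≤suc∸suc : ∀ x y → x ∸ y ≤ suc (x ∸ suc y)
∸≤suc∸suc zero    zero    = z≤n
∸≤suc∸suc zero    (suc y) = z≤n
∸≤suc∸suc (suc x) zero    = ≤-refl
∸≤suc∸suc (suc x) (suc y) = ∸≤suc∸suc x y

offset-inject₁ : ∀ {m} (j : Fin m) (p : Fin (suc m)) → offset (inject₁ j) p ≤ suc (offset (fsuc j) p)
offset-inject₁ {m} j p rewrite toℕ-inject₁ j with toℕ j ≤ᵇ toℕ p in j≤p | suc (toℕ j) ≤ᵇ toℕ p in 1+j≤p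
... | true  | true  = ∸≤suc∸suc (toℕ p) (toℕ j)
... | true  | false = ≤-trans (∸-monoˡ-≤ (toℕ j) (m≤n+m (toℕ p) (suc m))) (∸≤suc∸suc (suc m + toℕ p) (toℕ j))
... | false | true  = contradiction (≤⇒≤ᵇ (<⇒≤ (≤ᵇ⇒≤ (suc (toℕ j)) (toℕ p) (subst T (sym 1+j≤p) tt)))) (subst T j≤p)
... | false | false = ∸≤suc∸suc (suc m + toℕ p) (toℕ j)

offset-fromℕ : ∀ {m} (p : Fin (suc m)) → offset (fromℕ m) p ≤ suc (offset fzero p)
offset-fromℕ {m} p rewrite toℕ-fromℕ m with m ≤ᵇ toℕ p
... | true  = ≤-trans (m∸n≤m (toℕ p) m) (n≤1+n (toℕ p))
... | false = m≤n+o⇒m∸n≤o (suc m + toℕ p) m (≤-reflexive (sym (+-suc m (toℕ p))))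

NondecreasingAlong : ∀ {m} → (Fin (suc m) → ℕ) → Set
NondecreasingAlong {m} h = ∀ (j : Fin m) → h (inject₁ j) ≤ h (fsuc j)

nondecreasing⇒zero-least : ∀ {m} (h : Fin (suc m) → ℕ) → NondecreasingAlong h → ∀ i → h fzero ≤ h i
nondecreasing⇒zero-least         h step fzero    = ≤-refl
nondecreasing⇒zero-least {suc m} h step (fsuc i) =
  ≤-trans (nondecreasing⇒zero-least (h ∘ inject₁) (step ∘ inject₁) i) (step i)

nondecreasing⇒last-greatest : ∀ {m} (h : Fin (suc m) → ℕ) → NondecreasingAlong h → ∀ i → h i ≤ h (fromℕ m)
nondecreasing⇒last-greatest {zero}  h step fzero    = ≤-refl
nondecreasing⇒last-greatest {suc m} h step fzero    =
  ≤-trans (step fzero) (nondecreasing⇒last-greatest (h ∘ fsuc) (step ∘ fsuc) fzero)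
nondecreasing⇒last-greatest {suc m} h step (fsuc i) = nondecreasing⇒last-greatest (h ∘ fsuc) (step ∘ fsuc) i

cyclically-nondecreasing⇒constant : ∀ {m} (h : Fin (suc m) → ℕ) → NondecreasingAlong h → h (fromℕ m) ≤ h fzero →
                                    ∀ i → h i ≡ h fzero
cyclically-nondecreasing⇒constant h step wrap i =
  ≤-antisym (≤-trans (nondecreasing⇒last-greatest h step i) wrap) (nondecreasing⇒zero-least h step i)

module Intervals {m : ℕ} (σ : Permutation′ (suc m)) where

  open DecMembership (_≟ᶠ_ {suc m}) using () renaming (_∈?_ to _∈ᶠ?_)

  Interval : Set
  Interval = Σ (Subset (suc m)) (IsInterval σ)

  set : Interval → Subset (suc m)
  set = proj₁

  start : Interval → Fin (suc m)
  start = proj₁ ∘ proj₂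

  size : Interval → ℕ
  size = proj₁ ∘ proj₂ ∘ proj₂

  ∈-set⇔ : (A : Interval) → ∀ x → (x ∈ set A) ⇔ InInterval σ (start A) (size A) x
  ∈-set⇔ = proj₂ ∘ proj₂ ∘ proj₂ ∘ proj₂ ∘ proj₂

  ⊆-byOffsets : ∀ A B → (∀ p → offset (start A) p < size A → offset (start B) p < size B) → set A ⊆ set B
  ⊆-byOffsets A B offsets⊆ x∈A with Equivalence.to (∈-set⇔ A _) x∈A
  ... | p , σp≡x , p∈A = Equivalence.from (∈-set⇔ B _) (p , σp≡x , offsets⊆ p p∈A)

  ⊆-sameStart : ∀ A B → start A ≡ start B → size A ≤ size B → set A ⊆ set B
  ⊆-sameStart A B eq A≤B = ⊆-byOffsets A B (λ p p∈A → subst (λ i → offset i p < size B) eq (<-≤-trans p∈A A≤B))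

  fromAll : ∀ {G} → All (IsInterval σ) G → Σ (List Interval) λ es → map set es ≡ G
  fromAll []       = [] , refl
  fromAll (p ∷ ps) = (_ , p) ∷ proj₁ (fromAll ps) , cong (_ ∷_) (proj₂ (fromAll ps))

  record Antichain (es : List Interval) : Set where
    field
      unique : Unique es
      ⊆⇒≡    : ∀ {A B} → A ∈ₗ es → B ∈ₗ es → set A ⊆ set B → A ≡ B

  module AntichainProperties {es : List Interval} (ac : Antichain es) where
    open Antichain ac

    start-injective : ∀ {A B} → A ∈ₗ es → B ∈ₗ es → start A ≡ start B → A ≡ B
    start-injective {A} {B} A∈ B∈ eq with ≤-total (size A) (size B)
    ... | inj₁ A≤B = ⊆⇒≡ A∈ B∈ (⊆-sameStart A B eq A≤B)
    ... | inj₂ B≤A = sym (⊆⇒≡ B∈ A∈ (⊆-sameStart B A (sym eq) B≤A))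

    starts-unique : Unique (map start es)
    starts-unique = Unique-map⁺-on start-injective unique

    length≤ : length es ≤ suc m
    length≤ = subst (_≤ suc m) (length-map start es) (Unique⇒length≤n starts-unique)

    short-or-covering : length es < suc m ⊎ (∀ q → q ∈ₗ map start es)
    short-or-covering with all? (_∈ᶠ? map start es)
    ... | yes covering = inj₂ covering
    ... | no ¬covering with ¬∀⟶∃¬ (suc m) _ (_∈ᶠ? map start es) ¬covering
    ...   | q , q∉ = inj₁ (subst (λ k → suc k ≤ suc m) (length-map start es) (Unique⇒length≤n (q∉′ ∷ starts-unique)))
      where
        q∉′ : All (q ≢_) (map start es)
        q∉′ = All.tabulate (λ q′∈ q≡q′ → q∉ (subst (_∈ₗ map start es) (sym q≡q′) q′∈))

    size-mono : ∀ {A B} → A ∈ₗ es → B ∈ₗ es → (∀ p → offset (start A) p ≤ suc (offset (start B) p)) → size A ≤ size B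
    size-mono {A} {B} A∈ B∈ offsets≤ with size A ≤? size B
    ... | yes A≤B = A≤B
    ... | no  A≰B = contradiction (cong size (⊆⇒≡ B∈ A∈ B⊆A)) (<⇒≢ B<A)
      where
        B<A : size B < size A
        B<A = ≰⇒> A≰B
        B⊆A : set B ⊆ set A
        B⊆A = ⊆-byOffsets B A (λ p p∈B → ≤-<-trans (≤-trans (offsets≤ p) p∈B) B<A)

  module Covering {es : List Interval} (ac : Antichain es) (covering : ∀ q → q ∈ₗ map start es) where
    open AntichainProperties ac

    at : Fin (suc m) → Interval
    at q = proj₁ (∈-map⁻ start (covering q))

    at∈ : ∀ q → at q ∈ₗ es
    at∈ q = proj₁ (proj₂ (∈-map⁻ start (covering q)))

    start-at : ∀ q → start (at q) ≡ q
    start-at q = sym (proj₂ (proj₂ (∈-map⁻ start (covering q))))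

    size-at-mono : ∀ {i i′} → (∀ p → offset i p ≤ suc (offset i′ p)) → size (at i) ≤ size (at i′)
    size-at-mono {i} {i′} offsets≤ = size-mono (at∈ i) (at∈ i′) λ p →
      subst₂ (λ k k′ → offset k p ≤ suc (offset k′ p)) (sym (start-at i)) (sym (start-at i′)) (offsets≤ p)

    size-at-constant : ∀ q → size (at q) ≡ size (at fzero)
    size-at-constant =
      cyclically-nondecreasing⇒constant (size ∘ at) (λ j → size-at-mono (offset-inject₁ j)) (size-at-mono offset-fromℕ)

    sizes-equal : ∀ {A B} → A ∈ₗ es → B ∈ₗ es → size A ≡ size B
    sizes-equal A∈ B∈ = trans (size≡ A∈) (sym (size≡ B∈))
      where
        size≡ : ∀ {A} → A ∈ₗ es → size A ≡ size (at fzero)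
        size≡ {A} A∈ = trans (cong size (start-injective A∈ (at∈ (start A)) (sym (start-at (start A)))))
                             (size-at-constant (start A))

  module Family (es : List Interval) (sets-unique : Unique (map set es)) (two-sperner : TwoSperner (map set es))
                (L : List (Subset (suc m))) (L-unique : Unique L) (L-isolated : ∀ A → (A ∈ₗ L) ⇔ Isolated (map set es) A) where

    open DecMembership (≡-dec {n = suc m} Bool._≟_) using () renaming (_∈?_ to _∈ˢ?_)

    set-injective : ∀ {A B} → A ∈ₗ es → B ∈ₗ es → set A ≡ set B → A ≡ B
    set-injective = Unique-map⇒injective-on sets-unique

    Minimal : Interval → Set
    Minimal A = All (λ B → ¬ (set B ⊂ set A)) es

    minimal? : ∀ A → Dec (Minimal A)
    minimal? A = All.all? (λ B → ¬? (set B ⊂? set A)) es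

    minimals nonminimals isolated : List Interval
    minimals    = filter minimal? es
    nonminimals = filter (¬? ∘ minimal?) es
    isolated    = filter (λ A → set A ∈ˢ? L) es

    ∈-minimals⁻ : ∀ {A} → A ∈ₗ minimals → A ∈ₗ es × Minimal A
    ∈-minimals⁻ = ∈-filter⁻ minimal? {xs = es}

    ∈-nonminimals⁻ : ∀ {A} → A ∈ₗ nonminimals → A ∈ₗ es × ¬ Minimal A
    ∈-nonminimals⁻ = ∈-filter⁻ (¬? ∘ minimal?) {xs = es}

    nonminimal⇒⊃ : ∀ {A} → A ∈ₗ nonminimals → A ∈ₗ es × ∃ λ B → B ∈ₗ es × set B ⊂ set A
    nonminimal⇒⊃ {A} A∈ with ∈-nonminimals⁻ A∈
    ... | A∈es , ¬minimal with find (All.¬All⇒Any¬ (λ B → ¬? (set B ⊂? set A)) es ¬minimal)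
    ...   | B , B∈es , ¬¬B⊂A = A∈es , B , B∈es , decidable-stable (set B ⊂? set A) ¬¬B⊂A

    isolated⇒Isolated : ∀ {A} → A ∈ₗ isolated → A ∈ₗ es × Isolated (map set es) (set A)
    isolated⇒Isolated A∈ with ∈-filter⁻ (λ A → set A ∈ˢ? L) A∈
    ... | A∈es , setA∈L = A∈es , Equivalence.to (L-isolated _) setA∈L

    isolated⇒minimal : ∀ {A} → A ∈ₗ isolated → A ∈ₗ minimals
    isolated⇒minimal A∈ with isolated⇒Isolated A∈
    ... | A∈es , iso = ∈-filter⁺ minimal? A∈es (All.tabulate (λ B∈ → isolated⇒¬⊃ iso (∈-map⁺ set B∈)))

    L⊆sets-of-isolated : ∀ {A} → A ∈ₗ L → A ∈ₗ map set isolated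
    L⊆sets-of-isolated {A} A∈L with ∈-map⁻ set (proj₁ (Equivalence.to (L-isolated A) A∈L))
    ... | B , B∈es , refl = ∈-map⁺ set (∈-filter⁺ (λ A → set A ∈ˢ? L) B∈es A∈L)

    minimals-antichain : Antichain minimals
    minimals-antichain = record { unique = unique ; ⊆⇒≡ = ⊆⇒≡ }
      where
        unique : Unique minimals
        unique = Unique.filter⁺ minimal? (Unique.map⁻ sets-unique)
        ⊆⇒≡ : ∀ {A B} → A ∈ₗ minimals → B ∈ₗ minimals → set A ⊆ set B → A ≡ B
        ⊆⇒≡ A∈ B∈ A⊆B with ∈-minimals⁻ A∈ | ∈-minimals⁻ B∈ | ⊆⇒≡⊎⊂ A⊆B
        ... | A∈es , _ | B∈es , _          | inj₁ A≡B = set-injective A∈es B∈es A≡B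
        ... | A∈es , _ | _    , B-minimal  | inj₂ A⊂B = contradiction A⊂B (All.lookup B-minimal A∈es)

    nonminimals++isolated-antichain : Antichain (nonminimals ++ isolated)
    nonminimals++isolated-antichain = record { unique = unique ; ⊆⇒≡ = ⊆⇒≡ }
      where
        unique : Unique (nonminimals ++ isolated)
        unique = Unique.++⁺ (Unique.filter⁺ _ (Unique.map⁻ sets-unique)) (Unique.filter⁺ _ (Unique.map⁻ sets-unique))
                   (λ (A∈N , A∈I) → proj₂ (∈-nonminimals⁻ A∈N) (proj₂ (∈-minimals⁻ (isolated⇒minimal A∈I))))

        ∈es : ∀ {A} → A ∈ₗ nonminimals ++ isolated → A ∈ₗ es
        ∈es A∈ with ∈-++⁻ nonminimals A∈
        ... | inj₁ A∈N = proj₁ (nonminimal⇒⊃ A∈N)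
        ... | inj₂ A∈I = proj₁ (isolated⇒Isolated A∈I)

        ¬⊂ : ∀ {A B} → A ∈ₗ nonminimals ++ isolated → B ∈ₗ nonminimals ++ isolated → ¬ (set A ⊂ set B)
        ¬⊂ {A} {B} A∈ B∈ A⊂B with ∈-++⁻ nonminimals A∈ | ∈-++⁻ nonminimals B∈
        ... | inj₂ A∈I | _        = isolated⇒¬⊂ (proj₂ (isolated⇒Isolated A∈I)) (∈-map⁺ set (∈es B∈)) A⊂B
        ... | inj₁ _   | inj₂ B∈I = isolated⇒¬⊃ (proj₂ (isolated⇒Isolated B∈I)) (∈-map⁺ set (∈es A∈)) A⊂B
        ... | inj₁ A∈N | inj₁ _   with nonminimal⇒⊃ A∈N
        ...   | A∈es , C , C∈es , C⊂A = two-sperner (∈-map⁺ set C∈es) (∈-map⁺ set A∈es) (∈-map⁺ set (∈es B∈)) C⊂A A⊂B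

        ⊆⇒≡ : ∀ {A B} → A ∈ₗ nonminimals ++ isolated → B ∈ₗ nonminimals ++ isolated → set A ⊆ set B → A ≡ B
        ⊆⇒≡ A∈ B∈ A⊆B with ⊆⇒≡⊎⊂ A⊆B
        ... | inj₁ A≡B = set-injective (∈es A∈) (∈es B∈) A≡B
        ... | inj₂ A⊂B = contradiction A⊂B (¬⊂ A∈ B∈)

    length≤minimals+nonminimals : length es ≤ length minimals + length nonminimals
    length≤minimals+nonminimals = subst (length es ≤_) (length-++ minimals)
      (Unique⇒length≤ (Unique.map⁻ sets-unique) (λ {A} A∈ → split A∈ (minimal? A)))
      where
        split : ∀ {A} → A ∈ₗ es → Dec (Minimal A) → A ∈ₗ minimals ++ nonminimals
        split A∈ (yes minimal) = ∈-++⁺ˡ (∈-filter⁺ minimal? A∈ minimal)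
        split A∈ (no ¬minimal) = ∈-++⁺ʳ minimals (∈-filter⁺ (¬? ∘ minimal?) A∈ ¬minimal)

    length-L≤isolated : length L ≤ length isolated
    length-L≤isolated = subst (length L ≤_) (length-map set isolated) (Unique⇒length≤ L-unique L⊆sets-of-isolated)

    not-both-covering : ∀ {B A} → B ∈ₗ nonminimals → A ∈ₗ isolated →
                        (∀ q → q ∈ₗ map start minimals) → (∀ q → q ∈ₗ map start (nonminimals ++ isolated)) → ⊥
    not-both-covering {B} {A} B∈N A∈I covers-M covers-N′ = proj₂ (∈-nonminimals⁻ B∈N) B-minimal
      where
        module M-covering  = Covering minimals-antichain covers-M
        module N′-covering = Covering nonminimals++isolated-antichain covers-N′

        C : Interval
        C = M-covering.at (start B)

        C∈M : C ∈ₗ minimals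
        C∈M = M-covering.at∈ (start B)

        start-C : start C ≡ start B
        start-C = M-covering.start-at (start B)

        size-B≡size-C : size B ≡ size C
        size-B≡size-C = trans (N′-covering.sizes-equal (∈-++⁺ˡ B∈N) (∈-++⁺ʳ nonminimals A∈I))
                              (M-covering.sizes-equal (isolated⇒minimal A∈I) C∈M)

        B≡C : B ≡ C
        B≡C = set-injective (proj₁ (∈-nonminimals⁻ B∈N)) (proj₁ (∈-minimals⁻ C∈M))
                (⊆-antisym (⊆-sameStart B C (sym start-C) (≤-reflexive size-B≡size-C))
                           (⊆-sameStart C B start-C (≤-reflexive (sym size-B≡size-C))))

        B-minimal : Minimal B
        B-minimal = subst Minimal (sym B≡C) (proj₂ (∈-minimals⁻ C∈M))

    module M  = AntichainProperties minimals-antichain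
    module N′ = AntichainProperties nonminimals++isolated-antichain

    some-antichain-short : ∀ {B A} → B ∈ₗ nonminimals → A ∈ₗ isolated →
                           length minimals + length (nonminimals ++ isolated) < suc m + suc m
    some-antichain-short B∈N A∈I with M.short-or-covering | N′.short-or-covering
    ... | inj₁ M<n       | _              = +-mono-<-≤ M<n N′.length≤
    ... | inj₂ _         | inj₁ N′<n      = +-mono-≤-< M.length≤ N′<n
    ... | inj₂ covers-M  | inj₂ covers-N′ = ⊥-elim (not-both-covering B∈N A∈I covers-M covers-N′)

    length+isolated≤antichains : length es + length L ≤ length minimals + length (nonminimals ++ isolated)
    length+isolated≤antichains = begin
      length es + length L                                       ≤⟨ +-mono-≤ length≤minimals+nonminimals length-L≤isolated ⟩
      length minimals + length nonminimals + length isolated     ≡⟨ +-assoc (length minimals) _ _ ⟩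
      length minimals + (length nonminimals + length isolated)   ≡⟨ cong (length minimals +_) (length-++ nonminimals) ⟨
      length minimals + length (nonminimals ++ isolated)         ∎
      where open ≤-Reasoning

    length+isolated<2n : 1 ≤ length L → length L ≤ m → length es + length L < suc m + suc m
    length+isolated<2n 1≤I I≤m with nonminimals in N≡
    ... | []    = +-mono-≤-< es≤n (s≤s I≤m)
      where
        es≤n : length es ≤ suc m
        es≤n = ≤-trans (subst (λ N → length es ≤ length minimals + length N) N≡ length≤minimals+nonminimals)
                       (≤-trans (≤-reflexive (+-identityʳ _)) M.length≤)
    ... | B ∷ _ with ∈-map⁻ set (L⊆sets-of-isolated (proj₂ (nonempty⇒∃∈ 1≤I)))
    ...   | A , A∈I , _ =
      ≤-<-trans length+isolated≤antichains (some-antichain-short (subst (B ∈ₗ_) (sym N≡) (here refl)) A∈I)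

m+n<o+o⇒m≤2*o∸n∸1 : ∀ {m n o} → m + n < o + o → m ≤ (2 * o ∸ n) ∸ 1
m+n<o+o⇒m≤2*o∸n∸1 {m} {n} {o} m+n<o+o =
  subst (m ≤_) (sym (∸-+-assoc (2 * o) n 1))
    (m+n≤o⇒m≤o∸n m (subst₂ _≤_ (sym m+[n+1]≡1+m+n) (cong (o +_) (sym (+-identityʳ o))) m+n<o+o))
  where
    m+[n+1]≡1+m+n : m + (n + 1) ≡ suc (m + n)
    m+[n+1]≡1+m+n = trans (cong (m +_) (+-comm n 1)) (+-suc m n)

lemma5 : (n : ℕ) (σ : Permutation′ n) (G : List (Subset n)) (I : ℕ) →
    IsFamily G → All (IsInterval σ) G → TwoSperner G → NumIsolated G I →
    1 ≤ I → I ≤ n ∸ 1 →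
    length G ≤ (2 * n ∸ I) ∸ 1
lemma5 zero    σ G I _ _ _ _ 1≤I I≤0 = contradiction (≤-trans 1≤I I≤0) λ ()
lemma5 (suc m) σ G I G-unique G-intervals two-sperner (L , L-unique , L-isolated , refl) 1≤I I≤m
  with Intervals.fromAll σ G-intervals
... | es , refl = m+n<o+o⇒m≤2*o∸n∸1 {o = suc m}
                    (subst (λ k → k + length L < suc m + suc m) (sym (length-map proj₁ es)) (length+isolated<2n 1≤I I≤m))
  where open Intervals.Family σ es G-unique two-sperner L L-unique L-isolated
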